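{- Let $G$ be the $2\times 12$ grid graph whose top row is the path $\ell_t,\ell_{t,i},v_0,v_1,\dots,v_7,r_{t,i},r_t$, whose bottom row is the path $\ell_b,\ell_{b,i},u_0,u_1,\dots,u_7,r_{b,i},r_b$, with vertical edges $\ell_t\ell_b$, $\ell_{t,i}\ell_{b,i}$, $v_ju_j$ ($j=0,\dots,7$), $r_{t,i}r_{b,i}$, $r_tr_b$. Let $G'$ be the analogous $2\times 8$ grid graph with top row $\ell_t,\ell_{t,i},v_0,\dots,v_3,r_{t,i},r_t$ and bottom row $\ell_b,\ell_{b,i},u_0,\dots,u_3,r_{b,i},r_b$. Let $L=\{\ell_b,\ell_{b,i},\ell_t,\ell_{t,i}\}$, $R=\{r_b,r_{b,i},r_t,r_{t,i}\}$, $C=\{u_j,v_j: 0\le j\le 7\}$, $C'=\{u_j,v_j:0\le j\le 3\}$. Call a labeling of $G$ (resp. $G'$) with values in $\{ -1,1,2,3\}$ admissible if it satisfies the signed double Roman domination conditions (1)–(3) at every vertex except possibly $\ell_t,\ell_b,r_t,r_b$. For a fixed labeling $d$ of $L\cup R$, let $M(d)$ be the minimum of $\sum_{x\in C}f(x)$ over admissible labelings $f$ of $G$ agreeing with $d$ on $L\cup R$, and $M'(d)$ the minimum of $\sum_{x\in C'}f'(x)$ over admissible labelings $f'$ of $G'$ agreeing with $d$ on $L\cup R$ (where these exist). Then: (i) $M(d)\ge 6$ for every $d$ for which $M(d)$ is defined; (ii) if $M(d)=k$ with $k\in\{6,7,9\}$, then $M'(d)=k-4$.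
   Context: For a labeling $f$ of a graph with values in $\{ -1,1,2,3\}$, $V_i=f^{ -1}(i)$, $N(u)$ is the open neighborhood and $N[u]=N(u)\cup\{u\}$. The signed double Roman domination conditions at a vertex $u$ are: (1) if $u\in V_{ -1}$, $u$ has a neighbor in $V_3$ or at least two distinct neighbors in $V_2$; (2) if $u\in V_1$, $u$ has a neighbor in $V_2\cup V_3$; (3) $\sum_{x\in N[u]}f(x)\ge 1$. -}

module Defs where

open import Data.Nat using (ℕ; zero; suc; _≡ᵇ_; _≤ᵇ_)
open import Data.Integer using (ℤ; +_; -[1+_]; _+_; _≤_)
open import Data.Fin using (Fin; zero; suc; toℕ; fromℕ; inject₁)
import Data.Fin as Fin
open import Data.Bool using (Bool; true; false; if_then_else_; _∧_; _∨_; not)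
open import Data.Product using (_×_; _,_; ∃; ∃₂)
open import Data.Sum using (_⊎_)
open import Relation.Nullary using (¬_)
open import Relation.Nullary.Decidable using (⌊_⌋)
open import Relation.Binary.PropositionalEquality using (_≡_; _≢_)

data Lab : Set where
  neg one two three : Lab

val : Lab → ℤ
val neg   = -[1+ 0 ]
val one   = + 1
val two   = + 2
val three = + 3

sumFin : ∀ {n} → (Fin n → ℤ) → ℤ
sumFin {zero}  g = + 0
sumFin {suc n} g = g zero + sumFin (λ i → g (suc i))

-- Vertex (r , c): row r (0 = top, 1 = bottom), column c.
-- Columns 0,1 are ℓ, ℓ_i; columns 2..m+1 are the central columns (v_j/u_j with j = c-2);
-- columns m+2, m+3 are r_i, r.
W : ℕ → ℕ
W m = suc (suc (suc (suc m)))

V : ℕ → Set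
V m = Fin 2 × Fin (W m)

Labeling : ℕ → Set
Labeling m = V m → Lab

eqV : ∀ {m} → V m → V m → Bool
eqV (r , c) (r' , c') = ⌊ r Fin.≟ r' ⌋ ∧ ⌊ c Fin.≟ c' ⌋

adjB : ∀ {m} → V m → V m → Bool
adjB (r , c) (r' , c') =
  (not ⌊ r Fin.≟ r' ⌋ ∧ ⌊ c Fin.≟ c' ⌋)
  ∨ (⌊ r Fin.≟ r' ⌋ ∧ ((toℕ c' ≡ᵇ suc (toℕ c)) ∨ (toℕ c ≡ᵇ suc (toℕ c'))))

Adj : ∀ {m} → V m → V m → Set
Adj u x = adjB u x ≡ true

sumV : ∀ {m} → (V m → ℤ) → ℤ
sumV g = sumFin (λ r → sumFin (λ c → g (r , c)))

closedSum : ∀ {m} → Labeling m → V m → ℤ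
closedSum f u = sumV (λ x → if eqV x u ∨ adjB u x then val (f x) else + 0)

SDRDAt : ∀ {m} → Labeling m → V m → Set
SDRDAt f u =
  (f u ≡ neg →
     (∃ λ x → Adj u x × f x ≡ three)
     ⊎ (∃₂ λ x y → x ≢ y × Adj u x × Adj u y × f x ≡ two × f y ≡ two))
  × (f u ≡ one → ∃ λ x → Adj u x × (f x ≡ two ⊎ f x ≡ three))
  × (+ 1 ≤ closedSum f u)

Exempt : ∀ {m} → V m → Set
Exempt {m} (r , c) = toℕ c ≡ 0 ⊎ toℕ c ≡ suc (suc (suc m))

Admissible : ∀ {m} → Labeling m → Set
Admissible f = ∀ u → ¬ Exempt u → SDRDAt f u

-- boundary positions: 0 ↦ ℓ (col 0), 1 ↦ ℓ_i (col 1), 2 ↦ r_i (col m+2), 3 ↦ r (col m+3)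
bcol : ∀ m → Fin 4 → Fin (W m)
bcol m zero = zero
bcol m (suc zero) = suc zero
bcol m (suc (suc zero)) = inject₁ (fromℕ (suc (suc m)))
bcol m (suc (suc (suc zero))) = fromℕ (suc (suc (suc m)))

BLabeling : Set
BLabeling = Fin 2 × Fin 4 → Lab

Agrees : ∀ {m} → Labeling m → BLabeling → Set
Agrees {m} f d = ∀ r k → f (r , bcol m k) ≡ d (r , k)

central? : ∀ {m} → Fin (W m) → Bool
central? {m} c = (2 ≤ᵇ toℕ c) ∧ (toℕ c ≤ᵇ suc m)

centralSum : ∀ {m} → Labeling m → ℤ
centralSum f = sumV (λ { (r , c) → if central? c then val (f (r , c)) else + 0 })

IsMinVal : ℕ → BLabeling → ℤ → Set
IsMinVal m d k =
  (∃ λ (f : Labeling m) → Admissible f × Agrees f d × centralSum f ≡ k)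
  × (∀ (f : Labeling m) → Admissible f → Agrees f d → k ≤ centralSum f)

{-# OPTIONS --safe #-}

-- A labeling of the 2 × (m + 4) grid is a word of m + 4 columns, and the conditions at the two
-- vertices of a column only involve that column and its two neighbours. So the minimum of the
-- central sum over admissible labelings with boundary d is the minimum weight of a word whose
-- windows of three consecutive columns all pass a local test; dynamic programming over pairs of
-- adjacent columns computes it exactly, together with an optimal word. The right boundary
-- (r_i , r) matters only through the column r_i and the set of columns allowed before it, so 50
-- runs of the program, each covering all 256 left boundaries, decide both claims for every d.

module Submission where

open import Defs
open import Data.Bool using (Bool; true; false; T; not; _∧_; _∨_; if_then_else_)
open import Data.Bool.ListAction using (all; any)
open import Data.Bool.Properties using (T-∧; T-∨; T-≡; ∧-assoc; ∧-identityʳ)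
open import Data.Empty using (⊥-elim)
open import Data.Fin using (Fin; zero; suc; toℕ; fromℕ; inject₁; lower₁)
open import Data.Fin.Properties using (inject₁-lower₁; toℕ-inject₁-≢)
open import Data.Integer using (ℤ; +_; _+_; _-_; _≤_; _≤ᵇ_; _≟_)
import Data.Integer.Properties as ℤ
open import Algebra.Properties.CommutativeSemigroup ℤ.+-commutativeSemigroup using (interchange)
open import Data.List using (List; []; _∷_; _++_; map; foldr; length; filterᵇ; cartesianProduct; allFin; deduplicate)
import Data.List as List
import Data.List.Properties as List
open import Data.List.Membership.Propositional using (_∈_; find; lose)
open import Data.List.Membership.Propositional.Properties
  using (∈-filter⁺; ∈-filter⁻; ∈-cartesianProduct⁺; ∈-allFin; ∈-map⁺; ∈-deduplicate⁺)
import Data.List.Membership.DecPropositional as DecMembership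
import Data.List.Relation.Unary.All as All
import Data.List.Relation.Unary.All.Properties as All
import Data.List.Relation.Unary.AllPairs as AllPairs
open import Data.List.Relation.Unary.Any using (here; there)
import Data.List.Relation.Unary.Any.Properties as Any
open import Data.List.Relation.Unary.Unique.Propositional using (Unique)
import Data.List.Relation.Unary.Unique.Propositional.Properties as Unique
open import Data.Maybe using (Maybe; just; nothing)
open import Data.Maybe.Properties using (just-injective)
open import Data.Nat using (ℕ; zero; suc; z≤n; s≤s)
import Data.Nat as ℕ
import Data.Nat.Properties as ℕ
open import Data.Product using (_×_; _,_; proj₁; proj₂; ∃; ∃₂; uncurry)
import Data.Product.Properties as Product
open import Data.Sum using (_⊎_; inj₁; inj₂)
import Data.Sum as Sum
open import Data.Unit using (tt)
open import Data.Vec using (Vec; []; _∷_; _∷ʳ_; head; replicate)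
import Data.Vec as Vec
import Data.Vec.Properties as Vec
open import Function using (_∘_; _⇔_; mk⇔; Equivalence)
open import Relation.Binary.Definitions using (DecidableEquality)
open import Relation.Binary.PropositionalEquality
  using (_≡_; _≢_; refl; sym; trans; cong; cong₂; subst; subst₂; module ≡-Reasoning)
open import Relation.Nullary using (¬_; yes; no)
open import Relation.Nullary.Decidable using (⌊_⌋; toWitness; fromWitness; T?)

open Equivalence using (to; from)

-- Labels and the local conditions

_≟ₗ_ : DecidableEquality Lab
neg   ≟ₗ neg   = yes refl
neg   ≟ₗ one   = no λ ()
neg   ≟ₗ two   = no λ ()
neg   ≟ₗ three = no λ ()
one   ≟ₗ neg   = no λ ()
one   ≟ₗ one   = yes refl
one   ≟ₗ two   = no λ ()
one   ≟ₗ three = no λ ()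
two   ≟ₗ neg   = no λ ()
two   ≟ₗ one   = no λ ()
two   ≟ₗ two   = yes refl
two   ≟ₗ three = no λ ()
three ≟ₗ neg   = no λ ()
three ≟ₗ one   = no λ ()
three ≟ₗ two   = no λ ()
three ≟ₗ three = yes refl

_≡ᵇ_ : Lab → Lab → Bool
l ≡ᵇ l′ = ⌊ l ≟ₗ l′ ⌋

T-≡ᵇ : ∀ l′ l → T (l ≡ᵇ l′) ⇔ l ≡ l′
T-≡ᵇ l′ l = mk⇔ toWitness fromWitness

T-twoOrThree : ∀ l → T (l ≡ᵇ two ∨ l ≡ᵇ three) ⇔ (l ≡ two ⊎ l ≡ three)
T-twoOrThree l = mk⇔ (Sum.map (to (T-≡ᵇ two l)) (to (T-≡ᵇ three l)) ∘ to T-∨)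
                     (from T-∨ ∘ Sum.map (from (T-≡ᵇ two l)) (from (T-≡ᵇ three l)))

atLeastTwo : (Lab → Bool) → List Lab → Bool
atLeastTwo p ls = 2 ℕ.≤ᵇ length (filterᵇ p ls)

dominated : Lab → List Lab → Bool
dominated neg   ls = any (_≡ᵇ three) ls ∨ atLeastTwo (_≡ᵇ two) ls
dominated one   ls = any (λ l → l ≡ᵇ two ∨ l ≡ᵇ three) ls
dominated two   _  = true
dominated three _  = true

sumℤ : List ℤ → ℤ
sumℤ = foldr _+_ (+ 0)

localOK : Lab → List Lab → List Lab → Bool
localOK l neighbourLabels closedLabels =
  dominated l neighbourLabels ∧ (+ 1 ≤ᵇ sumℤ (map val closedLabels))

distinct-∈⇒2≤length : ∀ {A : Set} {x y : A} {zs} → x ∈ zs → y ∈ zs → x ≢ y → 2 ℕ.≤ length zs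
distinct-∈⇒2≤length {zs = _ ∷ _ ∷ _} _           _           _   = s≤s (s≤s z≤n)
distinct-∈⇒2≤length {zs = _ ∷ []}    (here refl) (here refl) x≢y = ⊥-elim (x≢y refl)

2≤length⇒distinct-∈ : ∀ {A : Set} {zs : List A} → Unique zs → 2 ℕ.≤ length zs →
                      ∃₂ λ x y → x ≢ y × x ∈ zs × y ∈ zs
2≤length⇒distinct-∈ {zs = x ∷ y ∷ _} ((x≢y All.∷ _) AllPairs.∷ _) _ =
  x , y , x≢y , here refl , there (here refl)
2≤length⇒distinct-∈ {zs = _ ∷ []} _ (s≤s ())

module _ {X : Set} (f : X → Lab) (p : Lab → Bool) where

  any-map⇔ : ∀ xs → (∃ λ x → x ∈ xs × T (p (f x))) ⇔ T (any p (map f xs))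
  any-map⇔ xs = mk⇔
    (λ (x , x∈xs , px) → Any.any⁺ p (Any.map⁺ (lose x∈xs px)))
    (λ h → find (Any.map⁻ (Any.any⁻ p (map f xs) h)))

  length-filter-map : ∀ xs → length (filterᵇ p (map f xs)) ≡ length (filterᵇ (p ∘ f) xs)
  length-filter-map []       = refl
  length-filter-map (x ∷ xs) with p (f x)
  ... | true  = cong suc (length-filter-map xs)
  ... | false = length-filter-map xs

  atLeastTwo-map⇔ : ∀ {xs} → Unique xs →
    (∃₂ λ x y → x ≢ y × x ∈ xs × y ∈ xs × T (p (f x)) × T (p (f y))) ⇔ T (atLeastTwo p (map f xs))
  atLeastTwo-map⇔ {xs} unique = mk⇔
    (λ (x , y , x≢y , x∈xs , y∈xs , px , py) →
       subst (T ∘ (2 ℕ.≤ᵇ_)) (sym (length-filter-map xs))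
         (ℕ.≤⇒≤ᵇ (distinct-∈⇒2≤length (∈-filter⁺ (T? ∘ p ∘ f) x∈xs px)
                                       (∈-filter⁺ (T? ∘ p ∘ f) y∈xs py) x≢y)))
    (λ h →
       let x , y , x≢y , x∈ys , y∈ys = 2≤length⇒distinct-∈ (Unique.filter⁺ (T? ∘ p ∘ f) unique)
             (ℕ.≤ᵇ⇒≤ 2 _ (subst (T ∘ (2 ℕ.≤ᵇ_)) (length-filter-map xs) h))
           x∈xs , px = ∈-filter⁻ (T? ∘ p ∘ f) x∈ys
           y∈xs , py = ∈-filter⁻ (T? ∘ p ∘ f) y∈ys
       in x , y , x≢y , x∈xs , y∈xs , px , py)

-- Neighbourhoods in the grid

vertices : ∀ m → List (V m)
vertices m = cartesianProduct (allFin 2) (allFin (W m))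

neighbours : ∀ {m} → V m → List (V m)
neighbours {m} u = filterᵇ (adjB u) (vertices m)

closedNeighbourhood : ∀ {m} → V m → List (V m)
closedNeighbourhood {m} u = filterᵇ (λ x → eqV x u ∨ adjB u x) (vertices m)

okAt : ∀ {m} → Labeling m → V m → Bool
okAt f u = localOK (f u) (map f (neighbours u)) (map f (closedNeighbourhood u))

∈-vertices : ∀ {m} (u : V m) → u ∈ vertices m
∈-vertices (r , c) = ∈-cartesianProduct⁺ (∈-allFin r) (∈-allFin c)

neighbours-unique : ∀ {m} (u : V m) → Unique (neighbours u)
neighbours-unique {m} u =
  Unique.filter⁺ (T? ∘ adjB u) (Unique.cartesianProduct⁺ (Unique.allFin⁺ 2) (Unique.allFin⁺ (W m)))

∈-neighbours⇔ : ∀ {m} (u x : V m) → x ∈ neighbours u ⇔ Adj u x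
∈-neighbours⇔ u x = mk⇔
  (λ x∈ → to T-≡ (proj₂ (∈-filter⁻ (T? ∘ adjB u) x∈)))
  (λ adj → ∈-filter⁺ (T? ∘ adjB u) (∈-vertices x) (from T-≡ adj))

sumFin≡sumℤ : ∀ {n} (g : Fin n → ℤ) → sumFin g ≡ sumℤ (List.tabulate g)
sumFin≡sumℤ {zero}  g = refl
sumFin≡sumℤ {suc n} g = cong (_+_ (g zero)) (sumFin≡sumℤ (g ∘ suc))

sumℤ-map-++ : ∀ {X : Set} (g : X → ℤ) xs ys → sumℤ (map g (xs ++ ys)) ≡ sumℤ (map g xs) + sumℤ (map g ys)
sumℤ-map-++ g []       ys = sym (ℤ.+-identityˡ _)
sumℤ-map-++ g (x ∷ xs) ys = trans (cong (_+_ (g x)) (sumℤ-map-++ g xs ys)) (sym (ℤ.+-assoc (g x) _ _))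

sumV≡sumℤ : ∀ {m} (g : V m → ℤ) → sumV g ≡ sumℤ (map g (vertices m))
sumV≡sumℤ {m} g = sym (begin
  sumℤ (map g (row zero ++ (row (suc zero) ++ [])))
    ≡⟨ sumℤ-map-++ g (row zero) _ ⟩
  sumℤ (map g (row zero)) + sumℤ (map g (row (suc zero) ++ []))
    ≡⟨ cong₂ _+_ (row-sum zero)
                 (trans (sumℤ-map-++ g (row (suc zero)) []) (cong (λ z → z + + 0) (row-sum (suc zero)))) ⟩
  sumV g ∎)
  where
  open ≡-Reasoning
  row : Fin 2 → List (V m)
  row r = map (r ,_) (allFin (W m))
  row-sum : ∀ r → sumℤ (map g (row r)) ≡ sumFin (λ c → g (r , c))
  row-sum r = begin
    sumℤ (map g (map (r ,_) (List.tabulate (λ c → c))))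
      ≡⟨ cong (sumℤ ∘ map g) (List.map-tabulate (λ c → c) (r ,_)) ⟩
    sumℤ (map g (List.tabulate (r ,_)))
      ≡⟨ cong sumℤ (List.map-tabulate (r ,_) g) ⟩
    sumℤ (List.tabulate (λ c → g (r , c)))
      ≡⟨ sym (sumFin≡sumℤ (λ c → g (r , c))) ⟩
    sumFin (λ c → g (r , c)) ∎

sumℤ-map-if : ∀ {X : Set} (p : X → Bool) (g : X → ℤ) xs →
  sumℤ (map (λ x → if p x then g x else + 0) xs) ≡ sumℤ (map g (filterᵇ p xs))
sumℤ-map-if p g []       = refl
sumℤ-map-if p g (x ∷ xs) with p x
... | true  = cong (_+_ (g x)) (sumℤ-map-if p g xs)
... | false = trans (ℤ.+-identityˡ _) (sumℤ-map-if p g xs)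

closedSum≡ : ∀ {m} (f : Labeling m) u → closedSum f u ≡ sumℤ (map val (map f (closedNeighbourhood u)))
closedSum≡ {m} f u = begin
  closedSum f u
    ≡⟨ sumV≡sumℤ (λ x → if eqV x u ∨ adjB u x then val (f x) else + 0) ⟩
  sumℤ (map (λ x → if eqV x u ∨ adjB u x then val (f x) else + 0) (vertices m))
    ≡⟨ sumℤ-map-if (λ x → eqV x u ∨ adjB u x) (val ∘ f) (vertices m) ⟩
  sumℤ (map (val ∘ f) (closedNeighbourhood u))
    ≡⟨ cong sumℤ (List.map-∘ (closedNeighbourhood u)) ⟩
  sumℤ (map val (map f (closedNeighbourhood u))) ∎
  where open ≡-Reasoning

module _ {m} (f : Labeling m) (u : V m) where

  HasNeighbour : (Lab → Set) → Set
  HasNeighbour P = ∃ λ x → Adj u x × P (f x)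

  HasTwoNeighbours : (Lab → Set) → Set
  HasTwoNeighbours P = ∃₂ λ x y → x ≢ y × Adj u x × Adj u y × P (f x) × P (f y)

  private
    labels : List Lab
    labels = map f (neighbours u)

  module _ {p : Lab → Bool} {P : Lab → Set} (reflects : ∀ l → T (p l) ⇔ P l) where

    HasNeighbour⇔ : HasNeighbour P ⇔ T (any p labels)
    HasNeighbour⇔ = mk⇔
      (λ (x , adj , Px) →
         to (any-map⇔ f p (neighbours u)) (x , from (∈-neighbours⇔ u x) adj , from (reflects (f x)) Px))
      (λ h → let x , x∈ , px = from (any-map⇔ f p (neighbours u)) h
             in x , to (∈-neighbours⇔ u x) x∈ , to (reflects (f x)) px)

    HasTwoNeighbours⇔ : HasTwoNeighbours P ⇔ T (atLeastTwo p labels)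
    HasTwoNeighbours⇔ = mk⇔ (to (atLeastTwo-map⇔ f p (neighbours-unique u)) ∘ members)
                            (adjacent ∘ from (atLeastTwo-map⇔ f p (neighbours-unique u)))
      where
      Members : Set
      Members = ∃₂ λ x y → x ≢ y × x ∈ neighbours u × y ∈ neighbours u × T (p (f x)) × T (p (f y))
      members : HasTwoNeighbours P → Members
      members (x , y , x≢y , adj-x , adj-y , Px , Py) =
        x , y , x≢y , from (∈-neighbours⇔ u x) adj-x , from (∈-neighbours⇔ u y) adj-y ,
        from (reflects (f x)) Px , from (reflects (f y)) Py
      adjacent : Members → HasTwoNeighbours P
      adjacent (x , y , x≢y , x∈ , y∈ , px , py) =
        x , y , x≢y , to (∈-neighbours⇔ u x) x∈ , to (∈-neighbours⇔ u y) y∈ ,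
        to (reflects (f x)) px , to (reflects (f y)) py

  SDRDAt⇒okAt : SDRDAt f u → T (okAt f u)
  SDRDAt⇒okAt (if-neg , if-one , sum≥1) =
    from T-∧ (dominated-at (f u) refl , ℤ.≤⇒≤ᵇ (subst (+ 1 ≤_) (closedSum≡ f u) sum≥1))
    where
    dominated-at : ∀ l → f u ≡ l → T (dominated l labels)
    dominated-at neg   e =
      from T-∨ (Sum.map (to (HasNeighbour⇔ (T-≡ᵇ three))) (to (HasTwoNeighbours⇔ (T-≡ᵇ two))) (if-neg e))
    dominated-at one   e = to (HasNeighbour⇔ T-twoOrThree) (if-one e)
    dominated-at two   _ = tt
    dominated-at three _ = tt

  okAt⇒SDRDAt : T (okAt f u) → SDRDAt f u
  okAt⇒SDRDAt ok = if-neg , if-one , subst (+ 1 ≤_) (sym (closedSum≡ f u)) (ℤ.≤ᵇ⇒≤ (proj₂ (to T-∧ ok)))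
    where
    dominated-at : ∀ {l} → f u ≡ l → T (dominated l labels)
    dominated-at e = subst (λ l → T (dominated l labels)) e (proj₁ (to T-∧ ok))
    if-neg : f u ≡ neg → HasNeighbour (_≡ three) ⊎ HasTwoNeighbours (_≡ two)
    if-neg e =
      Sum.map (from (HasNeighbour⇔ (T-≡ᵇ three))) (from (HasTwoNeighbours⇔ (T-≡ᵇ two))) (to T-∨ (dominated-at e))
    if-one : f u ≡ one → HasNeighbour (λ l → l ≡ two ⊎ l ≡ three)
    if-one e = from (HasNeighbour⇔ T-twoOrThree) (dominated-at e)

  SDRDAt⇔okAt : SDRDAt f u ⇔ T (okAt f u)
  SDRDAt⇔okAt = mk⇔ SDRDAt⇒okAt okAt⇒SDRDAt

okColumn : ∀ {m} → Labeling m → Fin (W m) → Bool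
okColumn f c = okAt f (zero , c) ∧ okAt f (suc zero , c)

interiorColumn : ∀ {m} → Fin (suc (suc m)) → Fin (W m)
interiorColumn j = suc (inject₁ j)

interiorColumns : ∀ m → List (Fin (W m))
interiorColumns m = List.tabulate interiorColumn

interiorOK : ∀ {m} → Labeling m → Bool
interiorOK {m} f = all (okColumn f) (interiorColumns m)

interior-not-exempt : ∀ {m} r (j : Fin (suc (suc m))) → ¬ Exempt {m} (r , interiorColumn j)
interior-not-exempt r j (inj₂ eq) = toℕ-inject₁-≢ j (sym (ℕ.suc-injective eq))

non-exempt-interior : ∀ {m} r (c : Fin (W m)) → ¬ Exempt {m} (r , c) → ∃ λ j → interiorColumn j ≡ c
non-exempt-interior r zero    ¬exempt = ⊥-elim (¬exempt (inj₁ refl))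
non-exempt-interior {m} r (suc c) ¬exempt = lower₁ c c≢last , cong suc (inject₁-lower₁ c c≢last)
  where
  c≢last : suc (suc m) ≢ toℕ c
  c≢last eq = ¬exempt (inj₂ (cong suc (sym eq)))

okColumn⇔ : ∀ {m} (f : Labeling m) c → T (okColumn f c) ⇔ (∀ r → T (okAt f (r , c)))
okColumn⇔ f c = mk⇔ (λ h → λ { zero → proj₁ (split h) ; (suc zero) → proj₂ (split h) })
                    (λ h → from (T-∧ {okAt f (zero , c)}) (h zero , h (suc zero)))
  where
  split : T (okColumn f c) → T (okAt f (zero , c)) × T (okAt f (suc zero , c))
  split = to T-∧

Admissible⇔interiorOK : ∀ {m} (f : Labeling m) → Admissible f ⇔ T (interiorOK f)
Admissible⇔interiorOK {m} f = mk⇔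
  (λ adm → All.all⁻ (okColumn f) (All.tabulate⁺ {f = interiorColumn} λ j →
     from (okColumn⇔ f (interiorColumn j)) λ r →
       to (SDRDAt⇔okAt f (r , interiorColumn j)) (adm (r , interiorColumn j) (interior-not-exempt r j))))
  (λ h (r , c) ¬exempt →
     let j , j↦c = non-exempt-interior r c ¬exempt
     in from (SDRDAt⇔okAt f (r , c)) (subst (λ c → T (okAt f (r , c))) j↦c
          (to (okColumn⇔ f (interiorColumn j)) (All.tabulate⁻ {f = interiorColumn} (All.all⁺ (okColumn f) _ h) j) r)))

-- Labelings as sequences of columns

Col : Set
Col = Lab × Lab

State : Set
State = Col × Col

cw : Col → ℤ
cw (a , b) = val a + val b

-- The neighbour lists are in the order in which `neighbours` enumerates them, so that on a grid
-- of concrete width `interiorOK f` evaluates to `windowsOK columnOK (columns f)` (used by Grid₈, Grid₄).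
columnOK : Col → Col → Col → Bool
columnOK (p₀ , p₁) (q₀ , q₁) (r₀ , r₁) =
  localOK q₀ (p₀ ∷ r₀ ∷ q₁ ∷ []) (p₀ ∷ q₀ ∷ r₀ ∷ q₁ ∷ []) ∧
  localOK q₁ (q₀ ∷ p₁ ∷ r₁ ∷ []) (q₀ ∷ p₁ ∷ q₁ ∷ r₁ ∷ [])

Path : Set → ℕ → Set
Path A n = Vec A (suc (suc n))

head2 : ∀ {A : Set} {n} → Path A n → A × A
head2 (a ∷ b ∷ _) = a , b

last2 : ∀ {A : Set} {n} → Path A n → A × A
last2 (a ∷ b ∷ [])    = a , b
last2 (a ∷ b ∷ c ∷ p) = last2 (b ∷ c ∷ p)

windowsOK : ∀ {A : Set} {n} → (A → A → A → Bool) → Vec A n → Bool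
windowsOK ok (a ∷ b ∷ c ∷ p) = ok a b c ∧ windowsOK ok (b ∷ c ∷ p)
windowsOK ok _               = true

windowsOK-cong : ∀ {A : Set} {n} {ok ok′ : A → A → A → Bool} → (∀ a b c → ok a b c ≡ ok′ a b c) →
                 (p : Vec A n) → windowsOK ok p ≡ windowsOK ok′ p
windowsOK-cong eq (a ∷ b ∷ c ∷ p) = cong₂ _∧_ (eq a b c) (windowsOK-cong eq (b ∷ c ∷ p))
windowsOK-cong eq []              = refl
windowsOK-cong eq (_ ∷ [])        = refl
windowsOK-cong eq (_ ∷ _ ∷ [])    = refl

windowsOK-∷ʳ : ∀ {A : Set} {n} (ok : A → A → A → Bool) (p : Path A n) z →
               windowsOK ok (p ∷ʳ z) ≡ windowsOK ok p ∧ uncurry ok (last2 p) z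
windowsOK-∷ʳ ok (a ∷ b ∷ [])    z = ∧-identityʳ (ok a b z)
windowsOK-∷ʳ ok (a ∷ b ∷ c ∷ p) z =
  trans (cong (ok a b c ∧_) (windowsOK-∷ʳ ok (b ∷ c ∷ p) z))
        (sym (∧-assoc (ok a b c) (windowsOK ok (b ∷ c ∷ p)) _))

tabulate-∷ʳ : ∀ {A : Set} {n} (h : Fin (suc n) → A) →
              Vec.tabulate h ≡ Vec.tabulate (h ∘ inject₁) ∷ʳ h (fromℕ n)
tabulate-∷ʳ {n = zero}  h = refl
tabulate-∷ʳ {n = suc n} h = cong (h zero ∷_) (tabulate-∷ʳ (h ∘ suc))

last2-tabulate : ∀ {A : Set} {n} (h : Fin (suc (suc n)) → A) → proj₂ (last2 (Vec.tabulate h)) ≡ h (fromℕ (suc n))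
last2-tabulate {n = zero}  h = refl
last2-tabulate {n = suc n} h = last2-tabulate (h ∘ suc)

col : ∀ {m} → Labeling m → Fin (W m) → Col
col f c = f (zero , c) , f (suc zero , c)

columns : ∀ {m} → Labeling m → Vec Col (W m)
columns f = Vec.tabulate (col f)

path : ∀ {m} → Labeling m → Path Col (suc m)
path f = Vec.tabulate (col f ∘ inject₁)

lastColumn : ∀ {m} → Labeling m → Col
lastColumn {m} f = col f (fromℕ (suc (suc (suc m))))

columns≡path∷ʳlast : ∀ {m} (f : Labeling m) → columns f ≡ path f ∷ʳ lastColumn f
columns≡path∷ʳlast f = tabulate-∷ʳ (col f)

cell : Fin 2 → Col → Lab
cell zero       = proj₁
cell (suc zero) = proj₂

fromColumns : ∀ {m} → Vec Col (W m) → Labeling m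
fromColumns q (r , c) = cell r (Vec.lookup q c)

columns-fromColumns : ∀ {m} (q : Vec Col (W m)) → columns (fromColumns q) ≡ q
columns-fromColumns q = Vec.tabulate∘lookup q

fromColumns-∷ʳ : ∀ {m} (p : Path Col (suc m)) z →
                 path (fromColumns (p ∷ʳ z)) ≡ p × lastColumn (fromColumns (p ∷ʳ z)) ≡ z
fromColumns-∷ʳ p z =
  Vec.∷ʳ-injective _ _ (trans (sym (columns≡path∷ʳlast (fromColumns (p ∷ʳ z)))) (columns-fromColumns (p ∷ʳ z)))

boundaryCol : BLabeling → Fin 4 → Col
boundaryCol d k = d (zero , k) , d (suc zero , k)

leftEnd : BLabeling → State
leftEnd d = boundaryCol d zero , boundaryCol d (suc zero)

rightEnd : BLabeling → State
rightEnd d = boundaryCol d (suc (suc zero)) , boundaryCol d (suc (suc (suc zero)))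

AgreesAtEnds : ∀ {m} → Labeling m → BLabeling → Set
AgreesAtEnds f d =
  head2 (path f) ≡ leftEnd d × proj₂ (last2 (path f)) ≡ proj₁ (rightEnd d) × lastColumn f ≡ proj₂ (rightEnd d)

Agrees⇔AgreesAtEnds : ∀ {m} (f : Labeling m) d → Agrees f d ⇔ AgreesAtEnds f d
Agrees⇔AgreesAtEnds {m} f d = mk⇔
  (λ agrees → let column = λ k → cong₂ _,_ (agrees zero k) (agrees (suc zero) k) in
     cong₂ _,_ (column zero) (column (suc zero)) ,
     trans (last2-tabulate (col f ∘ inject₁)) (column (suc (suc zero))) ,
     column (suc (suc (suc zero))))
  (λ ends → λ { zero k → cong proj₁ (column ends k) ; (suc zero) k → cong proj₂ (column ends k) })
  where
  column : AgreesAtEnds f d → ∀ k → col f (bcol m k) ≡ boundaryCol d k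
  column (left , _ , _)      zero                   = cong proj₁ left
  column (left , _ , _)      (suc zero)             = cong proj₂ left
  column (_ , right₀ , _)    (suc (suc zero))       = trans (sym (last2-tabulate (col f ∘ inject₁))) right₀
  column (_ , _ , right₁)    (suc (suc (suc zero))) = right₁

addIf : Bool → ℤ → ℤ → ℤ
addIf true  w v = w + v
addIf false w v = v

addIf-monoʳ-≤ : ∀ counted w {u v} → u ≤ v → addIf counted w u ≤ addIf counted w v
addIf-monoʳ-≤ true  w u≤v = ℤ.+-monoʳ-≤ w u≤v
addIf-monoʳ-≤ false w u≤v = u≤v

-- `counted` flags the second column of the path: a path's first and last columns never count.
weight : ∀ {A : Set} {n} → (A → ℤ) → Vec Bool n → Path A n → ℤ
weight w []                _       = + 0
weight w (counted ∷ flags) (a ∷ p) = addIf counted (w (head p)) (weight w flags p)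

sumFin-cong : ∀ {n} {g h : Fin n → ℤ} → (∀ i → g i ≡ h i) → sumFin g ≡ sumFin h
sumFin-cong {zero}  eq = refl
sumFin-cong {suc n} eq = cong₂ _+_ (eq zero) (sumFin-cong (eq ∘ suc))

sumFin-+ : ∀ {n} (g h : Fin n → ℤ) → sumFin g + sumFin h ≡ sumFin (λ i → g i + h i)
sumFin-+ {zero}  g h = refl
sumFin-+ {suc n} g h =
  trans (interchange (g zero) _ (h zero) _) (cong (_+_ (g zero + h zero)) (sumFin-+ (g ∘ suc) (h ∘ suc)))

sumFin-below : ∀ n (g : Fin (suc (suc n)) → ℤ) →
  sumFin (λ c → if toℕ c ℕ.<ᵇ n then g c else + 0) ≡ sumFin (λ j → g (inject₁ (inject₁ j)))
sumFin-below zero    g = refl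
sumFin-below (suc n) g = cong (_+_ (g zero)) (sumFin-below n (g ∘ suc))

weight-all : ∀ {A : Set} (w : A → ℤ) n (h : Fin (suc (suc n)) → A) →
  weight w (replicate n true) (Vec.tabulate h) ≡ sumFin (λ j → w (h (suc (inject₁ j))))
weight-all w zero    h = refl
weight-all w (suc n) h = cong (_+_ (w (h (suc zero)))) (weight-all w n (h ∘ suc))

centralFlags : ∀ m → Vec Bool (suc m)
centralFlags m = false ∷ replicate m true

centralSum≡weight : ∀ {m} (f : Labeling m) → centralSum f ≡ weight cw (centralFlags m) (path f)
centralSum≡weight {m} f = begin
  centralSum f
    ≡⟨ cong (_+_ (sumFin (onRow zero))) (ℤ.+-identityʳ _) ⟩
  sumFin (onRow zero) + sumFin (onRow (suc zero))
    ≡⟨ sumFin-+ (onRow zero) (onRow (suc zero)) ⟩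
  sumFin (λ c → onRow zero c + onRow (suc zero) c)
    ≡⟨ sumFin-cong (λ c → if-+ (central? {m} c) {val (f (zero , c))} {val (f (suc zero , c))}) ⟩
  sumFin (λ c → if central? {m} c then cw (col f c) else + 0)
    ≡⟨⟩
  + 0 + (+ 0 + sumFin (λ c → if toℕ c ℕ.<ᵇ m then cw (col f (suc (suc c))) else + 0))
    ≡⟨ trans (ℤ.+-identityˡ _) (ℤ.+-identityˡ _) ⟩
  sumFin (λ c → if toℕ c ℕ.<ᵇ m then cw (col f (suc (suc c))) else + 0)
    ≡⟨ sumFin-below m (λ c → cw (col f (suc (suc c)))) ⟩
  sumFin (λ j → cw (col f (suc (suc (inject₁ (inject₁ j))))))
    ≡⟨ sym (weight-all cw m (col f ∘ inject₁ ∘ suc)) ⟩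
  weight cw (centralFlags m) (path f) ∎
  where
  open ≡-Reasoning
  onRow : Fin 2 → Fin (W m) → ℤ
  onRow r c = if central? c then val (f (r , c)) else + 0
  if-+ : ∀ b {x y : ℤ} → (if b then x else + 0) + (if b then y else + 0) ≡ (if b then x + y else + 0)
  if-+ true  = refl
  if-+ false = refl

-- Minimum-weight paths under a sliding-window constraint

record Tabulation (X : Set) : Set₁ where
  field
    Table           : Set → Set
    tabulate        : {A : Set} → (X → A) → Table A
    lookup          : {A : Set} → Table A → X → A
    lookup∘tabulate : {A : Set} (g : X → A) (x : X) → lookup (tabulate g) x ≡ g x

  infixl 9 _!_

  _!_ : {A : Set} → Table (Table A) → X × X → A
  t ! (x , y) = lookup (lookup t x) y

  !-tabulate : {A : Set} (g : X → X → A) (x y : X) → tabulate (λ x → tabulate (g x)) ! (x , y) ≡ g x y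
  !-tabulate g x y = trans (cong (λ t → lookup t y) (lookup∘tabulate _ x)) (lookup∘tabulate _ y)

LabTable : Set → Set
LabTable A = A × A × A × A

lookupLab : {A : Set} → LabTable A → Lab → A
lookupLab (a , _ , _ , _) neg   = a
lookupLab (_ , b , _ , _) one   = b
lookupLab (_ , _ , c , _) two   = c
lookupLab (_ , _ , _ , d) three = d

labTabulation : Tabulation Lab
labTabulation = record
  { Table           = LabTable
  ; tabulate        = λ g → g neg , g one , g two , g three
  ; lookup          = lookupLab
  ; lookup∘tabulate = λ { g neg → refl ; g one → refl ; g two → refl ; g three → refl }
  }

_⊗_ : {X Y : Set} → Tabulation X → Tabulation Y → Tabulation (X × Y)
tx ⊗ ty = record
  { Table           = λ A → TX.Table (TY.Table A)
  ; tabulate        = λ g → TX.tabulate (λ x → TY.tabulate (λ y → g (x , y)))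
  ; lookup          = λ t (x , y) → TY.lookup (TX.lookup t x) y
  ; lookup∘tabulate = λ g (x , y) →
      trans (cong (λ t → TY.lookup t y) (TX.lookup∘tabulate _ x)) (TY.lookup∘tabulate _ y)
  }
  where
  module TX = Tabulation tx
  module TY = Tabulation ty

Entry : Set → ℕ → Set
Entry A n = Maybe (ℤ × Path A n)

if-just : ∀ {X : Set} b {e : Maybe X} {r} → (if b then e else nothing) ≡ just r → T b × e ≡ just r
if-just true e≡r = tt , e≡r

if-true : ∀ {X : Set} {b} {x y : X} → T b → (if b then x else y) ≡ x
if-true {b = true} _ = refl

-- The window constraint is given as a memo table so that it is evaluated once per run.
module MinimalPaths {A : Set} (tab : Tabulation A) (elements : List A) (∈-elements : ∀ a → a ∈ elements)
  (weightOf : A → ℤ)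
  (okTable : Tabulation.Table tab (Tabulation.Table tab (Tabulation.Table tab Bool)))
  (End : A × A → Bool) where

  open Tabulation tab

  ok : A → A → A → Bool
  ok a b c = lookup (lookup (lookup okTable a) b) c

  _⊓_ : ∀ {n} → Entry A n → Entry A n → Entry A n
  nothing      ⊓ e            = e
  just x       ⊓ nothing      = just x
  just (v , p) ⊓ just (w , q) = if v ≤ᵇ w then just (v , p) else just (w , q)

  least : ∀ {n} → (A → Entry A n) → List A → Entry A n
  least g = foldr (λ c e → g c ⊓ e) nothing

  extend : ∀ {n} → Bool → A → A → Entry A n → Entry A (suc n)
  extend counted a b nothing        = nothing
  extend counted a b (just (v , p)) = just (addIf counted (weightOf b) v , a ∷ p)

  candidate : ∀ {n} → Bool → A → A → Table Bool → Table (Entry A n) → A → Entry A (suc n)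
  candidate counted a b okRow row c = if lookup okRow c then extend counted a b (lookup row c) else nothing

  -- The rows are passed as arguments so that they are shared by all candidates.
  best : ∀ {n} → Bool → A → A → Table Bool → Table (Entry A n) → Entry A (suc n)
  best counted a b okRow row = least (candidate counted a b okRow row) elements

  step : ∀ {n} → Bool → Table (Table (Entry A n)) → Table (Table (Entry A (suc n)))
  step counted E = tabulate λ a → tabulate λ b → best counted a b (lookup (lookup okTable a) b) (lookup E b)

  initial : Table (Table (Entry A 0))
  initial = tabulate λ a → tabulate λ b → if End (a , b) then just (+ 0 , a ∷ b ∷ []) else nothing

  -- Opaque, so that the type checker evaluates the tables only where the check below asks for it.
  opaque
    run : ∀ {n} → Vec Bool n → Table (Table (Entry A n))
    run []                = initial
    run (counted ∷ flags) = step counted (run flags)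

  Valid : ∀ {n} → Path A n → Set
  Valid p = T (windowsOK ok p) × T (End (last2 p))

  Sound : ∀ {n} → Vec Bool n → Table (Table (Entry A n)) → Set
  Sound flags E = ∀ s v p → E ! s ≡ just (v , p) → Valid p × head2 p ≡ s × v ≡ weight weightOf flags p

  infix 4 _≼_

  _≼_ : ∀ {n} → Entry A n → ℤ → Set
  e ≼ w = ∃₂ λ v p → e ≡ just (v , p) × v ≤ w

  Optimal : ∀ {n} → Vec Bool n → Table (Table (Entry A n)) → Set
  Optimal flags E = ∀ p → Valid p → E ! head2 p ≼ weight weightOf flags p

  ⊓-sound : ∀ {n} (e e′ : Entry A n) {r} → e ⊓ e′ ≡ just r → e ≡ just r ⊎ e′ ≡ just r
  ⊓-sound nothing        e′             h = inj₂ h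
  ⊓-sound (just x)       nothing        h = inj₁ h
  ⊓-sound (just (v , p)) (just (w , q)) h with v ≤ᵇ w
  ... | true  = inj₁ h
  ... | false = inj₂ h

  ⊓-≼ˡ : ∀ {n w} (e e′ : Entry A n) → e ≼ w → (e ⊓ e′) ≼ w
  ⊓-≼ˡ nothing        _                (_ , _ , () , _)
  ⊓-≼ˡ (just x)       nothing          e≼w = e≼w
  ⊓-≼ˡ (just (v , p)) (just (v′ , p′)) (_ , _ , refl , v≤w) with v ≤ᵇ v′ in eq
  ... | true  = v , p , refl , v≤w
  ... | false = v′ , p′ , refl , ℤ.≤-trans (ℤ.<⇒≤ (ℤ.≰⇒> λ v≤v′ → subst T eq (ℤ.≤⇒≤ᵇ v≤v′))) v≤w

  ⊓-≼ʳ : ∀ {n w} (e e′ : Entry A n) → e′ ≼ w → (e ⊓ e′) ≼ w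
  ⊓-≼ʳ nothing        _                e′≼w = e′≼w
  ⊓-≼ʳ (just x)       nothing          (_ , _ , () , _)
  ⊓-≼ʳ (just (v , p)) (just (v′ , p′)) (_ , _ , refl , v′≤w) with v ≤ᵇ v′ in eq
  ... | true  = v , p , refl , ℤ.≤-trans (ℤ.≤ᵇ⇒≤ (subst T (sym eq) tt)) v′≤w
  ... | false = v′ , p′ , refl , v′≤w

  least-sound : ∀ {n} (g : A → Entry A n) cs {r} → least g cs ≡ just r → ∃ λ c → g c ≡ just r
  least-sound g (c ∷ cs) h with ⊓-sound (g c) (least g cs) h
  ... | inj₁ gc≡r  = c , gc≡r
  ... | inj₂ gcs≡r = least-sound g cs gcs≡r

  least-≼ : ∀ {n w} (g : A → Entry A n) {c cs} → c ∈ cs → g c ≼ w → least g cs ≼ w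
  least-≼ g {cs = c ∷ cs} (here refl) gc≼w = ⊓-≼ˡ (g c) (least g cs) gc≼w
  least-≼ g {cs = c ∷ cs} (there c∈)  gc≼w = ⊓-≼ʳ (g c) (least g cs) (least-≼ g c∈ gc≼w)

  extend-just : ∀ {n} counted a b (e : Entry A n) {r} → extend counted a b e ≡ just r →
                ∃₂ λ v p → e ≡ just (v , p) × r ≡ (addIf counted (weightOf b) v , a ∷ p)
  extend-just counted a b (just (v , p)) refl = v , p , refl , refl

  step-sound : ∀ {n} {flags : Vec Bool n} {E} counted →
               Sound flags E → Sound (counted ∷ flags) (step counted E)
  step-sound {E = E} counted sound (a , b) v p h
    with c , hc ← least-sound (candidate counted a b _ (lookup E b)) elements (trans (sym (!-tabulate _ a b)) h)
    with okabc , hext ← if-just (ok a b c) hc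
    with v₀ , b′ ∷ c′ ∷ q , e₀ , refl ← extend-just counted a b (E ! (b , c)) hext
    with (windows , end) , refl , refl ← sound (b , c) v₀ (b′ ∷ c′ ∷ q) e₀
    = (from T-∧ (okabc , windows) , end) , refl , refl

  step-optimal : ∀ {n} {flags : Vec Bool n} {E} counted →
                 Optimal flags E → Optimal (counted ∷ flags) (step counted E)
  step-optimal {E = E} counted optimal (a ∷ b ∷ c ∷ q) (windows , end)
    with okabc , windows′ ← to (T-∧ {ok a b c}) windows
    with v₀ , p₀ , e₀ , v₀≤ ← optimal (b ∷ c ∷ q) (windows′ , end)
    = subst (_≼ _) (sym (!-tabulate _ a b))
        (least-≼ (candidate counted a b _ (lookup E b)) (∈-elements c)
          (_ , _ , trans (if-true okabc) (cong (extend counted a b) e₀) , addIf-monoʳ-≤ counted (weightOf b) v₀≤))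

  initial-sound : Sound [] initial
  initial-sound (a , b) v p h with end , refl ← if-just (End (a , b)) (trans (sym (!-tabulate _ a b)) h)
    = (tt , end) , refl , refl

  initial-optimal : Optimal [] initial
  initial-optimal (a ∷ b ∷ []) (_ , end) = + 0 , a ∷ b ∷ [] , trans (!-tabulate _ a b) (if-true end) , ℤ.≤-refl

  opaque
    unfolding run

    run-sound : ∀ {n} (flags : Vec Bool n) → Sound flags (run flags)
    run-sound []                = initial-sound
    run-sound (counted ∷ flags) = step-sound counted (run-sound flags)

    run-optimal : ∀ {n} (flags : Vec Bool n) → Optimal flags (run flags)
    run-optimal []                = initial-optimal
    run-optimal (counted ∷ flags) = step-optimal counted (run-optimal flags)

-- The grids as path problems

_≟ᶜ_ : DecidableEquality Col
_≟ᶜ_ = Product.≡-dec _≟ₗ_ _≟ₗ_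

open DecMembership _≟ᶜ_ using (_∈?_)

allLabs : List Lab
allLabs = neg ∷ one ∷ two ∷ three ∷ []

∈-allLabs : ∀ l → l ∈ allLabs
∈-allLabs neg   = here refl
∈-allLabs one   = there (here refl)
∈-allLabs two   = there (there (here refl))
∈-allLabs three = there (there (there (here refl)))

allCols : List Col
allCols = cartesianProduct allLabs allLabs

∈-allCols : ∀ c → c ∈ allCols
∈-allCols (a , b) = ∈-cartesianProduct⁺ (∈-allLabs a) (∈-allLabs b)

allStates : List State
allStates = cartesianProduct allCols allCols

∈-allStates : ∀ s → s ∈ allStates
∈-allStates (x , y) = ∈-cartesianProduct⁺ (∈-allCols x) (∈-allCols y)

colTabulation : Tabulation Col
colTabulation = labTabulation ⊗ labTabulation

open Tabulation colTabulation using (Table; tabulate; lookup; lookup∘tabulate; _!_)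

okTable : Table (Table (Table Bool))
okTable = tabulate λ a → tabulate λ b → tabulate λ c → columnOK a b c

-- A right end (y₀ , y₁) enters the path problem only through y₀ and the columns allowed before y₀;
-- far fewer keys than right ends occur.
Key : Set
Key = Col × List Col

_≟ᵏ_ : DecidableEquality Key
_≟ᵏ_ = Product.≡-dec _≟ᶜ_ (List.≡-dec _≟ᶜ_)

rightKey : State → Key
rightKey (y₀ , y₁) = y₀ , filterᵇ (λ a → columnOK a y₀ y₁) allCols

endOK : Key → State → Bool
endOK (y₀ , predecessors) (a , b) = ⌊ b ≟ᶜ y₀ ⌋ ∧ ⌊ a ∈? predecessors ⌋

endOK-rightKey⇔ : ∀ {y₀ y₁ a b} →
                  T (endOK (rightKey (y₀ , y₁)) (a , b)) ⇔ (b ≡ y₀ × T (columnOK a y₀ y₁))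
endOK-rightKey⇔ {y₀} {y₁} {a} {b} = mk⇔
  (λ h → let b≡y₀ , a∈ = to (T-∧ {⌊ b ≟ᶜ y₀ ⌋}) h in
     toWitness b≡y₀ , proj₂ (∈-filter⁻ (T? ∘ λ a → columnOK a y₀ y₁) (toWitness a∈)))
  (λ (b≡y₀ , ok) → from (T-∧ {⌊ b ≟ᶜ y₀ ⌋}) (fromWitness b≡y₀ ,
     fromWitness {a? = a ∈? proj₂ (rightKey (y₀ , y₁))}
       (∈-filter⁺ (T? ∘ λ a → columnOK a y₀ y₁) (∈-allCols a) ok)))

okTable≡columnOK : ∀ a b c → lookup (lookup (lookup okTable a) b) c ≡ columnOK a b c
okTable≡columnOK a b c = begin
  lookup (lookup (lookup okTable a) b) c
    ≡⟨ cong (λ t → lookup (lookup t b) c)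
            (lookup∘tabulate (λ a → tabulate λ b → tabulate λ c → columnOK a b c) a) ⟩
  lookup (lookup (tabulate λ b → tabulate λ c → columnOK a b c) b) c
    ≡⟨ cong (λ t → lookup t c) (lookup∘tabulate (λ b → tabulate λ c → columnOK a b c) b) ⟩
  lookup (tabulate λ c → columnOK a b c) c
    ≡⟨ lookup∘tabulate (columnOK a b) c ⟩
  columnOK a b c ∎
  where open ≡-Reasoning

windowsOK-columns : ∀ {m} (ok : Col → Col → Col → Bool) (f : Labeling m) →
  windowsOK ok (columns f) ≡ windowsOK ok (path f) ∧ uncurry ok (last2 (path f)) (lastColumn f)
windowsOK-columns ok f = trans (cong (windowsOK ok) (columns≡path∷ʳlast f)) (windowsOK-∷ʳ ok (path f) (lastColumn f))

IsMinVal-unique : ∀ {m d a b} → IsMinVal m d a → IsMinVal m d b → a ≡ b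
IsMinVal-unique ((f , adm , agrees , f≡a) , a-min) ((g , adm′ , agrees′ , g≡b) , b-min) =
  ℤ.≤-antisym (subst (_ ≤_) g≡b (a-min g adm′ agrees′)) (subst (_ ≤_) f≡a (b-min f adm agrees))

module Grid (m : ℕ)
  (interiorOK≡windowsOK : ∀ (f : Labeling m) → interiorOK f ≡ windowsOK columnOK (columns f)) where

  module _ (d : BLabeling) where

    open MinimalPaths colTabulation allCols ∈-allCols cw okTable (endOK (rightKey (rightEnd d)))
      using (Valid; _≼_; run; run-sound; run-optimal)

    value : Entry Col (suc m)
    value = run (centralFlags m) ! leftEnd d

    windowsOK-memo : ∀ {n} (p : Vec Col n) →
                     windowsOK columnOK p ≡ windowsOK (λ a b c → lookup (lookup (lookup okTable a) b) c) p
    windowsOK-memo = windowsOK-cong (λ a b c → sym (okTable≡columnOK a b c))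

    valid-path : ∀ {f} → Admissible f → AgreesAtEnds f d → Valid (path f)
    valid-path {f} adm (_ , y₀-end , y₁-end) =
      subst T (windowsOK-memo (path f)) (proj₁ split) ,
      from endOK-rightKey⇔ (y₀-end , subst₂ (λ y₀ y₁ → T (columnOK _ y₀ y₁)) y₀-end y₁-end (proj₂ split))
      where
      split : T (windowsOK columnOK (path f)) × T (uncurry columnOK (last2 (path f)) (lastColumn f))
      split = to T-∧ (subst T (trans (interiorOK≡windowsOK f) (windowsOK-columns columnOK f))
                                (to (Admissible⇔interiorOK f) adm))

    labelingOf : Path Col (suc m) → Labeling m
    labelingOf p = fromColumns (p ∷ʳ proj₂ (rightEnd d))

    labelingOf-admissible : ∀ {p} → Valid p → head2 p ≡ leftEnd d →
                            Admissible (labelingOf p) × Agrees (labelingOf p) d × path (labelingOf p) ≡ p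
    labelingOf-admissible {p} (windows , end) p-left =
      from (Admissible⇔interiorOK g) (subst T (sym (trans (interiorOK≡windowsOK g) all-windows))
        (from T-∧ (subst T (sym (windowsOK-memo p)) windows ,
                   subst (λ y₀ → T (columnOK _ y₀ _)) (sym y₀-end) last-ok))) ,
      from (Agrees⇔AgreesAtEnds g d)
        (trans (cong head2 path≡p) p-left , trans (cong (proj₂ ∘ last2) path≡p) y₀-end , last≡y₁) ,
      path≡p
      where
      g : Labeling m
      g = labelingOf p
      y₀-end : proj₂ (last2 p) ≡ proj₁ (rightEnd d)
      y₀-end = proj₁ (to (endOK-rightKey⇔ {proj₁ (rightEnd d)} {proj₂ (rightEnd d)} {proj₁ (last2 p)}) end)
      last-ok : T (columnOK (proj₁ (last2 p)) (proj₁ (rightEnd d)) (proj₂ (rightEnd d)))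
      last-ok = proj₂ (to (endOK-rightKey⇔ {proj₁ (rightEnd d)} {proj₂ (rightEnd d)} {proj₁ (last2 p)}) end)
      path≡p : path g ≡ p
      path≡p = proj₁ (fromColumns-∷ʳ p (proj₂ (rightEnd d)))
      last≡y₁ : lastColumn g ≡ proj₂ (rightEnd d)
      last≡y₁ = proj₂ (fromColumns-∷ʳ p (proj₂ (rightEnd d)))
      all-windows : windowsOK columnOK (columns g) ≡ windowsOK columnOK p ∧ uncurry columnOK (last2 p) (proj₂ (rightEnd d))
      all-windows = trans (cong (windowsOK columnOK) (columns-fromColumns (p ∷ʳ proj₂ (rightEnd d))))
                          (windowsOK-∷ʳ columnOK p (proj₂ (rightEnd d)))

    value-≼ : ∀ {f} → Admissible f → Agrees f d → value ≼ centralSum f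
    value-≼ {f} adm agrees =
      subst₂ (λ s w → run (centralFlags m) ! s ≼ w) (proj₁ ends) (sym (centralSum≡weight f))
        (run-optimal (centralFlags m) (path f) (valid-path adm ends))
      where
      ends : AgreesAtEnds f d
      ends = to (Agrees⇔AgreesAtEnds f d) agrees

    value-isMin : ∀ {v p} → value ≡ just (v , p) → IsMinVal m d v
    value-isMin {v} {p} value≡v = minimal (run-sound (centralFlags m) (leftEnd d) v p value≡v)
      where
      minimal : Valid p × head2 p ≡ leftEnd d × v ≡ weight cw (centralFlags m) p → IsMinVal m d v
      minimal (valid , p-left , v≡weight) =
        let adm , agrees , path≡p = labelingOf-admissible valid p-left in
        (labelingOf p , adm , agrees ,
         trans (centralSum≡weight (labelingOf p)) (trans (cong (weight cw (centralFlags m)) path≡p) (sym v≡weight))) ,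
        λ f adm agrees →
          let v′ , _ , value≡v′ , v′≤ = value-≼ adm agrees
          in subst (_≤ centralSum f) (cong proj₁ (just-injective (trans (sym value≡v′) value≡v))) v′≤

-- The exhaustive check

IsTarget : ℤ → Set
IsTarget k = k ≡ + 6 ⊎ k ≡ + 7 ⊎ k ≡ + 9

isTarget : ℤ → Bool
isTarget k = ⌊ k ≟ + 6 ⌋ ∨ ⌊ k ≟ + 7 ⌋ ∨ ⌊ k ≟ + 9 ⌋

isTarget-complete : ∀ {k} → IsTarget k → T (isTarget k)
isTarget-complete (inj₁ refl)        = tt
isTarget-complete (inj₂ (inj₁ refl)) = tt
isTarget-complete (inj₂ (inj₂ refl)) = tt

hasValue : ∀ {n} → ℤ → Entry Col n → Bool
hasValue k nothing        = false
hasValue k (just (v , _)) = ⌊ v ≟ k ⌋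

hasValue-sound : ∀ {n k} (e : Entry Col n) → T (hasValue k e) → ∃ λ p → e ≡ just (k , p)
hasValue-sound (just (v , p)) h = p , cong (λ v → just (v , p)) (toWitness h)

verdict : ∀ {n n′} → Entry Col n → Entry Col n′ → Bool
verdict nothing        _  = true
verdict (just (v , _)) e′ = (+ 6 ≤ᵇ v) ∧ (not (isTarget v) ∨ hasValue (v - + 4) e′)

verdict-≥6 : ∀ {n n′} v (p : Path Col n) (e′ : Entry Col n′) → T (verdict (just (v , p)) e′) → + 6 ≤ v
verdict-≥6 v p e′ h = ℤ.≤ᵇ⇒≤ (proj₁ (to (T-∧ {+ 6 ≤ᵇ v}) h))

verdict-target : ∀ {n n′} v (p : Path Col n) (e′ : Entry Col n′) →
                 T (verdict (just (v , p)) e′) → IsTarget v → ∃ λ p′ → e′ ≡ just (v - + 4 , p′)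
verdict-target v p e′ h target with to T-∨ (proj₂ (to (T-∧ {+ 6 ≤ᵇ v}) h))
... | inj₁ not-target = ⊥-elim (subst (T ∘ not) (to T-≡ (isTarget-complete target)) not-target)
... | inj₂ has-value  = hasValue-sound e′ has-value

all-true : ∀ {A : Set} (p : A → Bool) {xs x} → all p xs ≡ true → x ∈ xs → p x ≡ true
all-true p {xs} h x∈xs = to T-≡ (All.lookup (All.all⁺ p xs (from T-≡ h)) x∈xs)

-- The memo table is a parameter so that it is built once for all keys, and the two tables are
-- arguments of verdictTables so that each is computed once.
module Check (table : Table (Table (Table Bool))) (k : Key) where

  open MinimalPaths colTabulation allCols ∈-allCols cw table (endOK k) using (run)

  verdictAt : State → Bool
  verdictAt s = verdict (run (centralFlags 8) ! s) (run (centralFlags 4) ! s)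

  keyOK : Bool
  keyOK = verdictTables (run (centralFlags 8)) (run (centralFlags 4))
    where
    verdictTables : ∀ {n n′} → Table (Table (Entry Col n)) → Table (Table (Entry Col n′)) → Bool
    verdictTables E E′ = all (λ s → verdict (E ! s) (E′ ! s)) allStates

  keyOK-sound : keyOK ≡ true → ∀ s → verdictAt s ≡ true
  keyOK-sound h s = all-true verdictAt {allStates} {s} h (∈-allStates s)

rightKeys : List Key
rightKeys = deduplicate _≟ᵏ_ (map rightKey allStates)

opaque
  unfolding MinimalPaths.run

  allKeysOK : all (Check.keyOK okTable) rightKeys ≡ true
  allKeysOK = refl

module Grid₈ = Grid 8 (λ f → refl)
module Grid₄ = Grid 4 (λ f → refl)

verdict-holds : ∀ d → verdict (Grid₈.value d) (Grid₄.value d) ≡ true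
verdict-holds d = Check.keyOK-sound okTable k key-ok (leftEnd d)
  where
  k : Key
  k = rightKey (rightEnd d)
  key-ok : Check.keyOK okTable k ≡ true
  key-ok = all-true (Check.keyOK okTable) {rightKeys} {k} allKeysOK
             (∈-deduplicate⁺ _≟ᵏ_ (∈-map⁺ rightKey (∈-allStates (rightEnd d))))

lemma1 : (∀ (d : BLabeling) (f : Labeling 8) → Admissible f → Agrees f d → + 6 ≤ centralSum f)
    × (∀ (d : BLabeling) (k : ℤ) → (k ≡ + 6 ⊎ k ≡ + 7 ⊎ k ≡ + 9) →
         IsMinVal 8 d k → IsMinVal 4 d (k - + 4))
lemma1 = centralSum≥6 , minimum-4
  where
  verdict-at : ∀ d v p → Grid₈.value d ≡ just (v , p) → T (verdict (just (v , p)) (Grid₄.value d))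
  verdict-at d v p value≡v = from T-≡ (subst (λ e → verdict e (Grid₄.value d) ≡ true) value≡v (verdict-holds d))

  centralSum≥6 : ∀ d (f : Labeling 8) → Admissible f → Agrees f d → + 6 ≤ centralSum f
  centralSum≥6 d f adm agrees =
    let v , p , value≡v , v≤ = Grid₈.value-≼ d adm agrees
    in ℤ.≤-trans (verdict-≥6 v p (Grid₄.value d) (verdict-at d v p value≡v)) v≤

  minimum-4 : ∀ d k → IsTarget k → IsMinVal 8 d k → IsMinVal 4 d (k - + 4)
  minimum-4 d k target min₈@((f , adm , agrees , _) , _) =
    let v , p , value≡v , _ = Grid₈.value-≼ d adm agrees
        v≡k = IsMinVal-unique (Grid₈.value-isMin d value≡v) min₈
        _ , value₄≡ = verdict-target v p (Grid₄.value d) (verdict-at d v p value≡v)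
                                     (subst IsTarget (sym v≡k) target)
    in subst (λ v → IsMinVal 4 d (v - + 4)) v≡k (Grid₄.value-isMin d value₄≡)
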